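{- For all integers $n, p \ge 0$ and every complex number $\mu$, $$\sum_{k=0}^n s(n,k)\binom{k}{p}\mu^k \;=\; \mu^p \sum_{k=0}^{n} \binom{n}{k}\binom{\mu}{k}\, s(n-k,p)\, k!,$$ where $\binom{\mu}{k} = \mu(\mu-1)\cdots(\mu-k+1)/k!$.
   Context: $s(n,k)$ denotes the (signed) Stirling numbers of the first kind, defined by $\frac{1}{p!}\ln^p(1+x) = \sum_{n\ge 0} s(n,p)\frac{x^n}{n!}$; in particular $s(0,0)=1$ and $s(n,p)=0$ for $n<p$. Binomial coefficients $\binom{k}{p}$ vanish for $p>k$. -}

module Defs where

open import Level using (Level)
open import Data.Nat using (ℕ; zero; suc)
open import Data.Integer as ℤ using (ℤ; +_; -[1+_])
open import Algebra.Bundles using (CommutativeRing)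

-- Signed Stirling numbers of the first kind, via the standard recurrence
--   s(0,0) = 1, s(0,k+1) = 0, s(n+1,0) = 0,
--   s(n+1,k+1) = s(n,k) - n * s(n,k+1),
-- equivalent to x(x-1)...(x-n+1) = Σ_k s(n,k) x^k, i.e. to the generating
-- function (1/p!) ln^p(1+x) = Σ_n s(n,p) x^n / n!.
stirling₁ : ℕ → ℕ → ℤ
stirling₁ zero    zero    = + 1
stirling₁ zero    (suc k) = + 0
stirling₁ (suc n) zero    = + 0
stirling₁ (suc n) (suc k) = stirling₁ n k ℤ.- ((+ n) ℤ.* stirling₁ n (suc k))

module _ {c ℓ : Level} (R : CommutativeRing c ℓ) where
  open CommutativeRing R using (Carrier; 0#; 1#; _+_; _*_; -_; _-_)

  ℕ⟶R : ℕ → Carrier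
  ℕ⟶R zero    = 0#
  ℕ⟶R (suc n) = 1# + ℕ⟶R n

  ℤ⟶R : ℤ → Carrier
  ℤ⟶R (+ n)      = ℕ⟶R n
  ℤ⟶R -[1+ n ]   = - ℕ⟶R (suc n)

  pow : Carrier → ℕ → Carrier
  pow μ zero    = 1#
  pow μ (suc k) = pow μ k * μ

  -- falling factorial μ(μ-1)...(μ-k+1)  ( = binom(μ,k) * k! )
  falling : Carrier → ℕ → Carrier
  falling μ zero    = 1#
  falling μ (suc k) = falling μ k * (μ - ℕ⟶R k)

  sumTo : ℕ → (ℕ → Carrier) → Carrier
  sumTo zero    f = f zero
  sumTo (suc n) f = sumTo n f + f (suc n)

module Submission where

-- Both sides satisfy, in n, the recurrence T(n+1,p) = (μ - n) T(n,p) + μ T(n,p-1) and agree at n = 0.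
-- For the left side this is the Stirling recurrence s(n+1,k+1) = s(n,k) - n s(n,k+1) combined with
-- Pascal's rule in k. For the sum r(n,p) on the right it is r(n+1,p) = (μ - n) r(n,p) + r(n,p-1), from
-- Pascal's rule in n, (μ)_{k+1} = (μ)_k (μ - k) and the Stirling recurrence in n - k. Conceptually,
-- both sides are the coefficient of t^p in the falling factorial (μ + μt)_n, expanded once through
-- (x)_n = Σ_k s(n,k) x^k and once through the Vandermonde identity for falling factorials.

open import Level using (Level)
open import Function using (_∘_)
open import Data.Nat as ℕ using (ℕ; zero; suc; _∸_; _≤_; _<_; z≤n; s≤s)
import Data.Nat.Properties as ℕ
open import Data.Nat.Combinatorics using (_C_; k>n⇒nCk≡0; nCk+nC[k+1]≡[n+1]C[k+1])
open import Data.Integer as ℤ using (ℤ; +_; -[1+_]; _⊖_)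
import Data.Integer.Properties as ℤ
open import Data.Sign as Sign using (Sign)
open import Data.Maybe as Maybe using (Maybe)
open import Data.Fin using (zero; suc)
open import Data.Vec using ([]; _∷_)
open import Relation.Binary.PropositionalEquality as ≡ using (_≡_)
open import Relation.Binary.Consequences using (dec⇒weaklyDec)
open import Algebra.Bundles using (CommutativeRing)
import Algebra.Solver.CommutativeMonoid as CommutativeMonoidSolver
import Algebra.Solver.Ring
open import Algebra.Solver.Ring.AlmostCommutativeRing
  using (fromCommutativeRing; _-Raw-AlmostCommutative⟶_)
open import Defs

module IntegerCast {c ℓ : Level} (R : CommutativeRing c ℓ) where
  open CommutativeRing R hiding (zero)
  open import Relation.Binary.Reasoning.Setoid setoid
  open import Algebra.Properties.Ring ring using (-1*x≈-x)
  open import Algebra.Properties.AbelianGroup +-abelianGroup using (⁻¹-∙-comm)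
  open import Algebra.Properties.Group +-group using (ε⁻¹≈ε; ⁻¹-involutive)
  open import Algebra.Properties.Semiring.Mult semiring using (_×_; ×-homo-+; ×1-homo-*)

  ℕ⟶R≡×1# : ∀ n → ℕ⟶R R n ≡ n × 1#
  ℕ⟶R≡×1# zero    = ≡.refl
  ℕ⟶R≡×1# (suc n) = ≡.cong (_+_ 1#) (ℕ⟶R≡×1# n)

  ℕ⟶R-homo-+ : ∀ m n → ℕ⟶R R (m ℕ.+ n) ≈ ℕ⟶R R m + ℕ⟶R R n
  ℕ⟶R-homo-+ m n rewrite ℕ⟶R≡×1# (m ℕ.+ n) | ℕ⟶R≡×1# m | ℕ⟶R≡×1# n = ×-homo-+ 1# m n

  ℕ⟶R-homo-* : ∀ m n → ℕ⟶R R (m ℕ.* n) ≈ ℕ⟶R R m * ℕ⟶R R n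
  ℕ⟶R-homo-* m n rewrite ℕ⟶R≡×1# (m ℕ.* n) | ℕ⟶R≡×1# m | ℕ⟶R≡×1# n = ×1-homo-* m n

  private
    +-cancelˡ-- : ∀ x a b → (x + a) - (x + b) ≈ a - b
    +-cancelˡ-- x a b = begin
      (x + a) + - (x + b)       ≈⟨ +-congˡ (sym (⁻¹-∙-comm x b)) ⟩
      (x + a) + (- x + - b)     ≈⟨ prove 4 ((x′ ⊕ a′) ⊕ (y′ ⊕ b′)) ((x′ ⊕ y′) ⊕ (a′ ⊕ b′)) (x ∷ a ∷ - x ∷ - b ∷ []) ⟩
      (x - x) + (a - b)         ≈⟨ +-congʳ (-‿inverseʳ x) ⟩
      0# + (a - b)              ≈⟨ +-identityˡ (a - b) ⟩
      a - b                     ∎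
      where
      open CommutativeMonoidSolver +-commutativeMonoid using (prove; _⊕_; var)
      x′ = var zero; a′ = var (suc zero); y′ = var (suc (suc zero)); b′ = var (suc (suc (suc zero)))

  ℤ⟶R-⊖ : ∀ m n → ℤ⟶R R (m ⊖ n) ≈ ℕ⟶R R m - ℕ⟶R R n
  ℤ⟶R-⊖ m       zero    = sym (trans (+-congˡ ε⁻¹≈ε) (+-identityʳ _))
  ℤ⟶R-⊖ zero    (suc n) = sym (+-identityˡ _)
  ℤ⟶R-⊖ (suc m) (suc n) = begin
    ℤ⟶R R (suc m ⊖ suc n)            ≡⟨ ≡.cong (ℤ⟶R R) (ℤ.[1+m]⊖[1+n]≡m⊖n m n) ⟩
    ℤ⟶R R (m ⊖ n)                    ≈⟨ ℤ⟶R-⊖ m n ⟩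
    ℕ⟶R R m - ℕ⟶R R n                ≈⟨ +-cancelˡ-- 1# _ _ ⟨
    ℕ⟶R R (suc m) - ℕ⟶R R (suc n)    ∎

  ℤ⟶R-homo-‿ : ∀ i → ℤ⟶R R (ℤ.- i) ≈ - ℤ⟶R R i
  ℤ⟶R-homo-‿ (+ zero)  = sym ε⁻¹≈ε
  ℤ⟶R-homo-‿ (+ suc n) = refl
  ℤ⟶R-homo-‿ -[1+ n ]  = sym (⁻¹-involutive _)

  ℤ⟶R-homo-+ : ∀ i j → ℤ⟶R R (i ℤ.+ j) ≈ ℤ⟶R R i + ℤ⟶R R j
  ℤ⟶R-homo-+ (+ m)    (+ n)    = ℕ⟶R-homo-+ m n
  ℤ⟶R-homo-+ (+ m)    -[1+ n ] = ℤ⟶R-⊖ m (suc n)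
  ℤ⟶R-homo-+ -[1+ m ] (+ n)    = trans (ℤ⟶R-⊖ n (suc m)) (+-comm _ _)
  ℤ⟶R-homo-+ -[1+ m ] -[1+ n ] = begin
    - ℕ⟶R R (suc (suc (m ℕ.+ n)))                 ≡⟨ ≡.cong (λ k → - ℕ⟶R R (suc k)) (ℕ.+-suc m n) ⟨
    - ℕ⟶R R (suc m ℕ.+ suc n)                     ≈⟨ -‿cong (ℕ⟶R-homo-+ (suc m) (suc n)) ⟩
    - (ℕ⟶R R (suc m) + ℕ⟶R R (suc n))             ≈⟨ ⁻¹-∙-comm _ _ ⟨
    - ℕ⟶R R (suc m) + - ℕ⟶R R (suc n)             ∎

  signR : Sign → Carrier
  signR Sign.+ = 1#
  signR Sign.- = - 1#

  signR-homo-* : ∀ s t → signR (s Sign.* t) ≈ signR s * signR t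
  signR-homo-* Sign.+ t      = sym (*-identityˡ _)
  signR-homo-* Sign.- Sign.+ = sym (*-identityʳ _)
  signR-homo-* Sign.- Sign.- = sym (trans (-1*x≈-x _) (⁻¹-involutive _))

  ℤ⟶R-◃ : ∀ s n → ℤ⟶R R (s ℤ.◃ n) ≈ signR s * ℕ⟶R R n
  ℤ⟶R-◃ s      zero    = sym (zeroʳ _)
  ℤ⟶R-◃ Sign.+ (suc n) = sym (*-identityˡ _)
  ℤ⟶R-◃ Sign.- (suc n) = sym (-1*x≈-x _)

  ℤ⟶R-sign-abs : ∀ i → ℤ⟶R R i ≈ signR (ℤ.sign i) * ℕ⟶R R ℤ.∣ i ∣
  ℤ⟶R-sign-abs i = trans (reflexive (≡.cong (ℤ⟶R R) (≡.sym (ℤ.◃-inverse i)))) (ℤ⟶R-◃ (ℤ.sign i) ℤ.∣ i ∣)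

  ℤ⟶R-homo-* : ∀ i j → ℤ⟶R R (i ℤ.* j) ≈ ℤ⟶R R i * ℤ⟶R R j
  ℤ⟶R-homo-* i j = begin
    ℤ⟶R R (i ℤ.* j)                   ≈⟨ ℤ⟶R-◃ (s Sign.* t) (m ℕ.* n) ⟩
    signR (s Sign.* t) * ℕ⟶R R (m ℕ.* n) ≈⟨ *-cong (signR-homo-* s t) (ℕ⟶R-homo-* m n) ⟩
    (signR s * signR t) * (ℕ⟶R R m * ℕ⟶R R n)
      ≈⟨ prove 4 ((a ⊕ b) ⊕ (x ⊕ y)) ((a ⊕ x) ⊕ (b ⊕ y)) (signR s ∷ signR t ∷ ℕ⟶R R m ∷ ℕ⟶R R n ∷ []) ⟩
    (signR s * ℕ⟶R R m) * (signR t * ℕ⟶R R n) ≈⟨ *-cong (ℤ⟶R-sign-abs i) (ℤ⟶R-sign-abs j) ⟨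
    ℤ⟶R R i * ℤ⟶R R j                 ∎
    where
    s = ℤ.sign i; t = ℤ.sign j; m = ℤ.∣ i ∣; n = ℤ.∣ j ∣
    open CommutativeMonoidSolver *-commutativeMonoid using (prove; _⊕_; var)
    a = var zero; b = var (suc zero); x = var (suc (suc zero)); y = var (suc (suc (suc zero)))

  ℤ⟶R-morphism : ℤ.+-*-rawRing -Raw-AlmostCommutative⟶ fromCommutativeRing R
  ℤ⟶R-morphism = record
    { ⟦_⟧    = ℤ⟶R R
    ; +-homo = ℤ⟶R-homo-+
    ; *-homo = ℤ⟶R-homo-*
    ; -‿homo = ℤ⟶R-homo-‿
    ; 0-homo = refl
    ; 1-homo = +-identityʳ 1#
    }

  ℤ⟶R-≟ : ∀ i j → Maybe (ℤ⟶R R i ≈ ℤ⟶R R j)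
  ℤ⟶R-≟ i j = Maybe.map (reflexive ∘ ≡.cong (ℤ⟶R R)) (dec⇒weaklyDec ℤ._≟_ i j)

  open Algebra.Solver.Ring ℤ.+-*-rawRing (fromCommutativeRing R) ℤ⟶R-morphism ℤ⟶R-≟ public
    using (solve; _:+_; _:*_; _:-_; _:=_; con)

module SumTo {c ℓ : Level} (R : CommutativeRing c ℓ) where
  open CommutativeRing R hiding (zero)
  open IntegerCast R using (solve; _:+_; _:*_; _:-_; _:=_)

  sumTo-cong≤ : ∀ n {f g : ℕ → Carrier} → (∀ k → k ≤ n → f k ≈ g k) → sumTo R n f ≈ sumTo R n g
  sumTo-cong≤ zero    f≈g = f≈g 0 z≤n
  sumTo-cong≤ (suc n) f≈g = +-cong (sumTo-cong≤ n (λ k k≤n → f≈g k (ℕ.m≤n⇒m≤1+n k≤n))) (f≈g (suc n) ℕ.≤-refl)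

  sumTo-cong : ∀ n {f g : ℕ → Carrier} → (∀ k → f k ≈ g k) → sumTo R n f ≈ sumTo R n g
  sumTo-cong n f≈g = sumTo-cong≤ n (λ k _ → f≈g k)

  sumTo-≈0 : ∀ n (f : ℕ → Carrier) → (∀ k → f k ≈ 0#) → sumTo R n f ≈ 0#
  sumTo-≈0 zero    f f≈0 = f≈0 0
  sumTo-≈0 (suc n) f f≈0 = trans (+-cong (sumTo-≈0 n f f≈0) (f≈0 (suc n))) (+-identityˡ 0#)

  sumTo-head : ∀ n (f : ℕ → Carrier) → sumTo R (suc n) f ≈ f 0 + sumTo R n (f ∘ suc)
  sumTo-head zero    f = refl
  sumTo-head (suc n) f = trans (+-congʳ (sumTo-head n f)) (+-assoc _ _ _)

  sumTo-shift : ∀ n (f : ℕ → Carrier) → f (suc n) ≈ 0# → f 0 + sumTo R n (f ∘ suc) ≈ sumTo R n f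
  sumTo-shift n f fn+1≈0 = trans (sym (sumTo-head n f)) (trans (+-congˡ fn+1≈0) (+-identityʳ _))

  sumTo-distrib-+ : ∀ n (f g : ℕ → Carrier) → sumTo R n (λ k → f k + g k) ≈ sumTo R n f + sumTo R n g
  sumTo-distrib-+ zero    f g = refl
  sumTo-distrib-+ (suc n) f g = trans (+-congʳ (sumTo-distrib-+ n f g))
    (solve 4 (λ a b x y → (a :+ b) :+ (x :+ y) := (a :+ x) :+ (b :+ y)) refl (sumTo R n f) (sumTo R n g) (f (suc n)) (g (suc n)))

  sumTo-distrib-- : ∀ n (f g : ℕ → Carrier) → sumTo R n (λ k → f k - g k) ≈ sumTo R n f - sumTo R n g
  sumTo-distrib-- zero    f g = refl
  sumTo-distrib-- (suc n) f g = trans (+-congʳ (sumTo-distrib-- n f g))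
    (solve 4 (λ a b x y → (a :- b) :+ (x :- y) := (a :+ x) :- (b :+ y)) refl (sumTo R n f) (sumTo R n g) (f (suc n)) (g (suc n)))

  *-distribˡ-sumTo : ∀ n x (f : ℕ → Carrier) → x * sumTo R n f ≈ sumTo R n (λ k → x * f k)
  *-distribˡ-sumTo zero    x f = refl
  *-distribˡ-sumTo (suc n) x f = trans (distribˡ x _ _) (+-congʳ (*-distribˡ-sumTo n x f))

module StirlingBinomial {c ℓ : Level} (R : CommutativeRing c ℓ) where
  open CommutativeRing R hiding (zero)
  open import Relation.Binary.Reasoning.Setoid setoid
  open IntegerCast R
  open SumTo R

  stirlingᴿ : ℕ → ℕ → Carrier
  stirlingᴿ n k = ℤ⟶R R (stirling₁ n k)

  binomialᴿ : ℕ → ℕ → Carrier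
  binomialᴿ n k = ℕ⟶R R (n C k)

  prev : (ℕ → Carrier) → ℕ → Carrier
  prev f zero    = 0#
  prev f (suc p) = f p

  n*stirlingᴿ[n,0]≈0 : ∀ n → ℕ⟶R R n * stirlingᴿ n 0 ≈ 0#
  n*stirlingᴿ[n,0]≈0 zero    = zeroˡ _
  n*stirlingᴿ[n,0]≈0 (suc n) = zeroʳ _

  stirlingᴿ-suc : ∀ n p → stirlingᴿ (suc n) p ≈ prev (stirlingᴿ n) p - ℕ⟶R R n * stirlingᴿ n p
  stirlingᴿ-suc n zero    = begin
    0#                                    ≈⟨ -‿inverseʳ 0# ⟨
    0# - 0#                               ≈⟨ +-congˡ (-‿cong (n*stirlingᴿ[n,0]≈0 n)) ⟨
    0# - ℕ⟶R R n * stirlingᴿ n 0          ∎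
  stirlingᴿ-suc n (suc p) = begin
    ℤ⟶R R (stirling₁ n p ℤ.- + n ℤ.* stirling₁ n (suc p))       ≈⟨ ℤ⟶R-homo-+ (stirling₁ n p) _ ⟩
    stirlingᴿ n p + ℤ⟶R R (ℤ.- (+ n ℤ.* stirling₁ n (suc p)))    ≈⟨ +-congˡ (ℤ⟶R-homo-‿ (+ n ℤ.* stirling₁ n (suc p))) ⟩
    stirlingᴿ n p - ℤ⟶R R (+ n ℤ.* stirling₁ n (suc p))         ≈⟨ +-congˡ (-‿cong (ℤ⟶R-homo-* (+ n) (stirling₁ n (suc p)))) ⟩
    stirlingᴿ n p - ℕ⟶R R n * stirlingᴿ n (suc p)               ∎

  stirlingᴿ-vanish : ∀ {n k} → n < k → stirlingᴿ n k ≈ 0#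
  stirlingᴿ-vanish {zero}  {suc k} _         = refl
  stirlingᴿ-vanish {suc n} {suc k} (s≤s n<k) = begin
    stirlingᴿ (suc n) (suc k)                   ≈⟨ stirlingᴿ-suc n (suc k) ⟩
    stirlingᴿ n k - ℕ⟶R R n * stirlingᴿ n (suc k)
      ≈⟨ +-cong (stirlingᴿ-vanish n<k) (-‿cong (*-congˡ (stirlingᴿ-vanish (ℕ.m≤n⇒m≤1+n n<k)))) ⟩
    0# - ℕ⟶R R n * 0#                           ≈⟨ solve 1 (λ x → con (+ 0) :- x :* con (+ 0) := con (+ 0)) refl (ℕ⟶R R n) ⟩
    0#                                          ∎

  binomialᴿ-suc : ∀ n k → binomialᴿ (suc n) k ≈ prev (binomialᴿ n) k + binomialᴿ n k
  binomialᴿ-suc n zero    = sym (+-identityˡ _)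
  binomialᴿ-suc n (suc k) = begin
    ℕ⟶R R (suc n C suc k)             ≡⟨ ≡.cong (ℕ⟶R R) (nCk+nC[k+1]≡[n+1]C[k+1] n k) ⟨
    ℕ⟶R R (n C k ℕ.+ n C suc k)       ≈⟨ ℕ⟶R-homo-+ (n C k) (n C suc k) ⟩
    binomialᴿ n k + binomialᴿ n (suc k) ∎

  binomialᴿ-vanish : ∀ {n k} → n < k → binomialᴿ n k ≈ 0#
  binomialᴿ-vanish n<k = reflexive (≡.cong (ℕ⟶R R) (k>n⇒nCk≡0 n<k))

  stirlingTransform-suc : ∀ n (w : ℕ → Carrier) →
    sumTo R (suc n) (λ k → stirlingᴿ (suc n) k * w k)
      ≈ sumTo R n (λ k → stirlingᴿ n k * w (suc k)) - ℕ⟶R R n * sumTo R n (λ k → stirlingᴿ n k * w k)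
  stirlingTransform-suc n w = begin
    sumTo R (suc n) (λ k → stirlingᴿ (suc n) k * w k)
      ≈⟨ sumTo-head n _ ⟩
    0# * w 0 + sumTo R n (λ k → stirlingᴿ (suc n) (suc k) * w (suc k))
      ≈⟨ +-cong (zeroˡ (w 0)) (sumTo-cong n (λ k → *-congʳ (stirlingᴿ-suc n (suc k)))) ⟩
    0# + sumTo R n (λ k → (stirlingᴿ n k - ℕ⟶R R n * stirlingᴿ n (suc k)) * w (suc k))
      ≈⟨ +-identityˡ _ ⟩
    sumTo R n (λ k → (stirlingᴿ n k - ℕ⟶R R n * stirlingᴿ n (suc k)) * w (suc k))
      ≈⟨ sumTo-cong n (λ k → solve 4 (λ s s′ m w′ → (s :- m :* s′) :* w′ := s :* w′ :- m :* (s′ :* w′)) refl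
                        (stirlingᴿ n k) (stirlingᴿ n (suc k)) (ℕ⟶R R n) (w (suc k))) ⟩
    sumTo R n (λ k → stirlingᴿ n k * w (suc k) - ℕ⟶R R n * (stirlingᴿ n (suc k) * w (suc k)))
      ≈⟨ sumTo-distrib-- n _ _ ⟩
    sumTo R n (λ k → stirlingᴿ n k * w (suc k)) - sumTo R n (λ k → ℕ⟶R R n * (stirlingᴿ n (suc k) * w (suc k)))
      ≈⟨ +-congˡ (-‿cong (trans (sym (*-distribˡ-sumTo n _ _)) dropHead)) ⟩
    sumTo R n (λ k → stirlingᴿ n k * w (suc k)) - ℕ⟶R R n * sumTo R n (λ k → stirlingᴿ n k * w k)
      ∎
    where
    f : ℕ → Carrier
    f k = stirlingᴿ n k * w k
    n*f0≈0 : ℕ⟶R R n * f 0 ≈ 0#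
    n*f0≈0 = trans (sym (*-assoc _ _ _)) (trans (*-congʳ (n*stirlingᴿ[n,0]≈0 n)) (zeroˡ _))
    f[n+1]≈0 : f (suc n) ≈ 0#
    f[n+1]≈0 = trans (*-congʳ (stirlingᴿ-vanish {n} ℕ.≤-refl)) (zeroˡ _)
    -- The k = 0 term lost in the index shift is annihilated by the factor n, as s(n,0) = 0 for n > 0.
    dropHead : ℕ⟶R R n * sumTo R n (f ∘ suc) ≈ ℕ⟶R R n * sumTo R n f
    dropHead = begin
      ℕ⟶R R n * sumTo R n (f ∘ suc)                  ≈⟨ +-identityˡ _ ⟨
      0# + ℕ⟶R R n * sumTo R n (f ∘ suc)             ≈⟨ +-congʳ n*f0≈0 ⟨
      ℕ⟶R R n * f 0 + ℕ⟶R R n * sumTo R n (f ∘ suc) ≈⟨ distribˡ _ _ _ ⟨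
      ℕ⟶R R n * (f 0 + sumTo R n (f ∘ suc))          ≈⟨ *-congˡ (sumTo-shift n f f[n+1]≈0) ⟩
      ℕ⟶R R n * sumTo R n f                          ∎

  module _ (μ : Carrier) where

    fallingConvolution-suc : ∀ n (a : ℕ → Carrier) →
      sumTo R (suc n) (λ k → binomialᴿ (suc n) k * falling R μ k * a (suc n ∸ k))
        ≈ sumTo R n (λ k → binomialᴿ n k * falling R μ k * ((μ - ℕ⟶R R k) * a (n ∸ k) + a (suc n ∸ k)))
    fallingConvolution-suc n a = begin
      sumTo R (suc n) (λ k → binomialᴿ (suc n) k * falling R μ k * a (suc n ∸ k))
        ≈⟨ sumTo-head n _ ⟩
      g 0 + sumTo R n (λ k → binomialᴿ (suc n) (suc k) * falling R μ (suc k) * a (n ∸ k))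
        ≈⟨ +-congˡ (sumTo-cong n pascal) ⟩
      g 0 + sumTo R n (λ k → g (suc k) + d k)
        ≈⟨ +-congˡ (sumTo-distrib-+ n _ _) ⟩
      g 0 + (sumTo R n (g ∘ suc) + sumTo R n d)
        ≈⟨ +-assoc _ _ _ ⟨
      (g 0 + sumTo R n (g ∘ suc)) + sumTo R n d
        ≈⟨ +-congʳ (sumTo-shift n g g[n+1]≈0) ⟩
      sumTo R n g + sumTo R n d
        ≈⟨ +-comm _ _ ⟩
      sumTo R n d + sumTo R n g
        ≈⟨ sumTo-distrib-+ n _ _ ⟨
      sumTo R n (λ k → d k + g k)
        ≈⟨ sumTo-cong n (λ k → distribˡ _ _ _) ⟨
      sumTo R n (λ k → binomialᴿ n k * falling R μ k * ((μ - ℕ⟶R R k) * a (n ∸ k) + a (suc n ∸ k)))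
        ∎
      where
      g d : ℕ → Carrier
      g k = binomialᴿ n k * falling R μ k * a (suc n ∸ k)
      d k = binomialᴿ n k * falling R μ k * ((μ - ℕ⟶R R k) * a (n ∸ k))
      g[n+1]≈0 : g (suc n) ≈ 0#
      g[n+1]≈0 = trans (*-congʳ (*-congʳ (binomialᴿ-vanish {n} ℕ.≤-refl))) (trans (*-congʳ (zeroˡ _)) (zeroˡ _))
      pascal : ∀ k → binomialᴿ (suc n) (suc k) * falling R μ (suc k) * a (n ∸ k) ≈ g (suc k) + d k
      pascal k = begin
        binomialᴿ (suc n) (suc k) * (falling R μ k * (μ - ℕ⟶R R k)) * a (n ∸ k)
          ≈⟨ *-congʳ (*-congʳ (binomialᴿ-suc n (suc k))) ⟩
        (binomialᴿ n k + binomialᴿ n (suc k)) * (falling R μ k * (μ - ℕ⟶R R k)) * a (n ∸ k)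
          ≈⟨ solve 5 (λ b b′ x y z → (b :+ b′) :* (x :* y) :* z := b′ :* (x :* y) :* z :+ b :* x :* (y :* z)) refl
               (binomialᴿ n k) (binomialᴿ n (suc k)) (falling R μ k) (μ - ℕ⟶R R k) (a (n ∸ k)) ⟩
        g (suc k) + d k ∎

    stirlingPowerSum : ℕ → ℕ → Carrier
    stirlingPowerSum n p = sumTo R n (λ k → stirlingᴿ n k * binomialᴿ k p * pow R μ k)

    binomialFallingSum : ℕ → ℕ → Carrier
    binomialFallingSum n p = sumTo R n (λ k → binomialᴿ n k * falling R μ k * stirlingᴿ (n ∸ k) p)

    stirlingPowerSum-suc : ∀ n p →
      stirlingPowerSum (suc n) p ≈ (μ - ℕ⟶R R n) * stirlingPowerSum n p + μ * prev (stirlingPowerSum n) p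
    stirlingPowerSum-suc n p = begin
      stirlingPowerSum (suc n) p
        ≈⟨ sumTo-cong (suc n) (λ k → *-assoc _ _ _) ⟩
      sumTo R (suc n) (λ k → stirlingᴿ (suc n) k * w k)
        ≈⟨ stirlingTransform-suc n w ⟩
      sumTo R n (λ k → stirlingᴿ n k * w (suc k)) - ℕ⟶R R n * sumTo R n (λ k → stirlingᴿ n k * w k)
        ≈⟨ +-cong (sumTo-cong n pascal) (-‿cong (*-congˡ (sumTo-cong n (λ k → sym (*-assoc _ _ _))))) ⟩
      sumTo R n (λ k → μ * t k + μ * t′ k) - ℕ⟶R R n * stirlingPowerSum n p
        ≈⟨ +-congʳ (trans (sumTo-distrib-+ n _ _) (sym (+-cong (*-distribˡ-sumTo n μ t) (*-distribˡ-sumTo n μ t′)))) ⟩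
      (μ * stirlingPowerSum n p + μ * sumTo R n t′) - ℕ⟶R R n * stirlingPowerSum n p
        ≈⟨ +-congʳ (+-congˡ (*-congˡ (prevSum p))) ⟩
      (μ * stirlingPowerSum n p + μ * prev (stirlingPowerSum n) p) - ℕ⟶R R n * stirlingPowerSum n p
        ≈⟨ solve 4 (λ m L P x → (m :* L :+ m :* P) :- x :* L := (m :- x) :* L :+ m :* P) refl
             μ (stirlingPowerSum n p) (prev (stirlingPowerSum n) p) (ℕ⟶R R n) ⟩
      (μ - ℕ⟶R R n) * stirlingPowerSum n p + μ * prev (stirlingPowerSum n) p
        ∎
      where
      w t t′ : ℕ → Carrier
      w k = binomialᴿ k p * pow R μ k
      t k = stirlingᴿ n k * binomialᴿ k p * pow R μ k
      t′ k = stirlingᴿ n k * prev (binomialᴿ k) p * pow R μ k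
      pascal : ∀ k → stirlingᴿ n k * w (suc k) ≈ μ * t k + μ * t′ k
      pascal k = begin
        stirlingᴿ n k * (binomialᴿ (suc k) p * (pow R μ k * μ))
          ≈⟨ *-congˡ (*-congʳ (binomialᴿ-suc k p)) ⟩
        stirlingᴿ n k * ((prev (binomialᴿ k) p + binomialᴿ k p) * (pow R μ k * μ))
          ≈⟨ solve 5 (λ s b′ b x m → s :* ((b′ :+ b) :* (x :* m)) := m :* (s :* b :* x) :+ m :* (s :* b′ :* x)) refl
               (stirlingᴿ n k) (prev (binomialᴿ k) p) (binomialᴿ k p) (pow R μ k) μ ⟩
        μ * t k + μ * t′ k ∎
      prevSum : ∀ q → sumTo R n (λ k → stirlingᴿ n k * prev (binomialᴿ k) q * pow R μ k) ≈ prev (stirlingPowerSum n) q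
      prevSum zero    = sumTo-≈0 n _ (λ k → trans (*-congʳ (zeroʳ _)) (zeroˡ _))
      prevSum (suc q) = refl

    binomialFallingSum-suc : ∀ n p →
      binomialFallingSum (suc n) p ≈ (μ - ℕ⟶R R n) * binomialFallingSum n p + prev (binomialFallingSum n) p
    binomialFallingSum-suc n p = begin
      binomialFallingSum (suc n) p
        ≈⟨ fallingConvolution-suc n (λ m → stirlingᴿ m p) ⟩
      sumTo R n (λ k → binomialᴿ n k * falling R μ k * ((μ - ℕ⟶R R k) * stirlingᴿ (n ∸ k) p + stirlingᴿ (suc n ∸ k) p))
        ≈⟨ sumTo-cong≤ n stirlingStep ⟩
      sumTo R n (λ k → (μ - ℕ⟶R R n) * t k + t′ k)
        ≈⟨ sumTo-distrib-+ n _ _ ⟩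
      sumTo R n (λ k → (μ - ℕ⟶R R n) * t k) + sumTo R n t′
        ≈⟨ +-cong (sym (*-distribˡ-sumTo n _ t)) (prevSum p) ⟩
      (μ - ℕ⟶R R n) * binomialFallingSum n p + prev (binomialFallingSum n) p
        ∎
      where
      t t′ : ℕ → Carrier
      t k = binomialᴿ n k * falling R μ k * stirlingᴿ (n ∸ k) p
      t′ k = binomialᴿ n k * falling R μ k * prev (stirlingᴿ (n ∸ k)) p
      stirlingStep : ∀ k → k ≤ n →
        binomialᴿ n k * falling R μ k * ((μ - ℕ⟶R R k) * stirlingᴿ (n ∸ k) p + stirlingᴿ (suc n ∸ k) p)
          ≈ (μ - ℕ⟶R R n) * t k + t′ k
      stirlingStep k k≤n = begin
        b * x * ((μ - ℕ⟶R R k) * s + stirlingᴿ (suc n ∸ k) p)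
          ≡⟨ ≡.cong (λ j → b * x * ((μ - ℕ⟶R R k) * s + stirlingᴿ j p)) (ℕ.+-∸-assoc 1 k≤n) ⟩
        b * x * ((μ - ℕ⟶R R k) * s + stirlingᴿ (suc m) p)
          ≈⟨ *-congˡ (+-congˡ (stirlingᴿ-suc m p)) ⟩
        b * x * ((μ - ℕ⟶R R k) * s + (s′ - ℕ⟶R R m * s))
          ≈⟨ solve 7 (λ b x μ k m s s′ → b :* x :* ((μ :- k) :* s :+ (s′ :- m :* s)) := (μ :- (m :+ k)) :* (b :* x :* s) :+ b :* x :* s′) refl
               b x μ (ℕ⟶R R k) (ℕ⟶R R m) s s′ ⟩
        (μ - (ℕ⟶R R m + ℕ⟶R R k)) * t k + t′ k
          ≈⟨ +-congʳ (*-congʳ (+-congˡ (-‿cong (trans (sym (ℕ⟶R-homo-+ m k)) (reflexive (≡.cong (ℕ⟶R R) (ℕ.m∸n+n≡m k≤n))))))) ⟩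
        (μ - ℕ⟶R R n) * t k + t′ k
          ∎
        where
        m = n ∸ k
        b = binomialᴿ n k
        x = falling R μ k
        s = stirlingᴿ m p
        s′ = prev (stirlingᴿ m) p
      prevSum : ∀ q → sumTo R n (λ k → binomialᴿ n k * falling R μ k * prev (stirlingᴿ (n ∸ k)) q) ≈ prev (binomialFallingSum n) q
      prevSum zero    = sumTo-≈0 n _ (λ k → zeroʳ _)
      prevSum (suc q) = refl

    stirlingPowerSum₀≈μ^p*binomialFallingSum₀ : ∀ p → stirlingPowerSum 0 p ≈ pow R μ p * binomialFallingSum 0 p
    stirlingPowerSum₀≈μ^p*binomialFallingSum₀ zero    = trans (*-identityʳ _) (sym (trans (*-identityˡ _) (*-congʳ (*-identityʳ _))))
    stirlingPowerSum₀≈μ^p*binomialFallingSum₀ (suc p) =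
      solve 2 (λ u x → con (+ 1) :* con (+ 0) :* u := x :* (con (+ 1) :* u :* con (+ 0))) refl 1# (pow R μ (suc p))

mainTheorem1 : {c ℓ : Level} (R : CommutativeRing c ℓ) (n p : ℕ) (μ : CommutativeRing.Carrier R) →
    CommutativeRing._≈_ R
      (sumTo R n (λ k → CommutativeRing._*_ R (CommutativeRing._*_ R (ℤ⟶R R (stirling₁ n k)) (ℕ⟶R R (k C p))) (pow R μ k)))
      (CommutativeRing._*_ R (pow R μ p)
        (sumTo R n (λ k → CommutativeRing._*_ R (CommutativeRing._*_ R (ℕ⟶R R (n C k)) (falling R μ k)) (ℤ⟶R R (stirling₁ (n ∸ k) p)))))
mainTheorem1 R zero    p μ = StirlingBinomial.stirlingPowerSum₀≈μ^p*binomialFallingSum₀ R μ p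
mainTheorem1 R (suc n) p μ = begin
  S (suc n) p                                       ≈⟨ stirlingPowerSum-suc μ n p ⟩
  (μ - ℕ⟶R R n) * S n p + μ * prev (S n) p          ≈⟨ +-cong (*-congˡ (mainTheorem1 R n p μ)) (prevStep p) ⟩
  (μ - ℕ⟶R R n) * (pow R μ p * B n p) + pow R μ p * prev (B n) p
    ≈⟨ solve 4 (λ a x b b′ → a :* (x :* b) :+ x :* b′ := x :* (a :* b :+ b′)) refl (μ - ℕ⟶R R n) (pow R μ p) (B n p) (prev (B n) p) ⟩
  pow R μ p * ((μ - ℕ⟶R R n) * B n p + prev (B n) p) ≈⟨ *-congˡ (binomialFallingSum-suc μ n p) ⟨
  pow R μ p * B (suc n) p                           ∎
  where
  open CommutativeRing R hiding (zero)
  open import Relation.Binary.Reasoning.Setoid setoid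
  open IntegerCast R using (solve; _:+_; _:*_; _:=_)
  open StirlingBinomial R
  S B : ℕ → ℕ → Carrier
  S = stirlingPowerSum μ
  B = binomialFallingSum μ
  prevStep : ∀ q → μ * prev (S n) q ≈ pow R μ q * prev (B n) q
  prevStep zero    = trans (zeroʳ μ) (sym (zeroʳ 1#))
  prevStep (suc q) = begin
    μ * S n q                  ≈⟨ *-congˡ (mainTheorem1 R n q μ) ⟩
    μ * (pow R μ q * B n q)    ≈⟨ solve 3 (λ m x b → m :* (x :* b) := x :* m :* b) refl μ (pow R μ q) (B n q) ⟩
    pow R μ q * μ * B n q      ∎
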